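{- $\mathbb{P}(G_3)$ does not satisfy transitivity: there exist $\Gamma,\Delta\subseteq For$ and $\alpha\in For$ such that $\Delta\vDash^{\mathbb{P}}_{G_3}\alpha$ and $\Gamma\vDash^{\mathbb{P}}_{G_3}\delta$ for all $\delta\in\Delta$, but $\Gamma\nvDash^{\mathbb{P}}_{G_3}\alpha$.
   Context: $For$ is the set of formulas built from a countable set $Prop$ of propositional letters with $\neg,\vee,\wedge,\rightarrow$. $G_3$ (Gödel) is given by the matrix with truth values $\{0,1/2,1\}$, designated set $\{1\}$, $f_\neg(0)=1$ and $f_\neg(x)=0$ for $x\neq 0$, $f_\vee=\max$, $f_\wedge=\min$, $f_\rightarrow(x,y)=1$ if $x\le y$ and $=y$ if $x>y$; valuations are maps $Prop\to\{0,1/2,1\}$ extended via these functions. $\Gamma\vDash_{G_3}\alpha$ iff every valuation giving all members of $\Gamma$ value $1$ gives $\alpha$ value $1$; $\Gamma$ is $G_3$-consistent iff $\{\alpha:\Gamma\vDash_{G_3}\alpha\}\neq For$. $\Gamma\vDash^{\mathbb{P}}_{G_3}\alpha$ iff there exists a $G_3$-consistent $\Gamma'\subseteq\Gamma$ with $\Gamma'\vDash_{G_3}\alpha$. -}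

module Defs where

open import Data.Nat using (ℕ)
open import Data.Product using (Σ; _×_)
open import Data.Empty using (⊥)
open import Relation.Binary.PropositionalEquality using (_≡_)
open import Relation.Unary using (Pred; _⊆_; _∈_)
open import Level using (0ℓ)

Prop : Set
Prop = ℕ

data For : Set where
  var  : Prop → For
  ¬'_  : For → For
  _∨'_ : For → For → For
  _∧'_ : For → For → For
  _⇒'_ : For → For → For

data V : Set where
  v0 v½ v1 : V

f¬ : V → V
f¬ v0 = v1
f¬ v½ = v0
f¬ v1 = v0

f∨ : V → V → V
f∨ v1 _  = v1
f∨ _  v1 = v1
f∨ v½ _  = v½
f∨ _  v½ = v½
f∨ v0 v0 = v0

f∧ : V → V → V
f∧ v0 _  = v0
f∧ _  v0 = v0
f∧ v½ _  = v½
f∧ _  v½ = v½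
f∧ v1 v1 = v1

f⇒ : V → V → V
f⇒ v0 _  = v1
f⇒ v½ v0 = v0
f⇒ v½ _  = v1
f⇒ v1 y  = y

Valuation : Set
Valuation = Prop → V

⟦_⟧ : For → Valuation → V
⟦ var p ⟧ v = v p
⟦ ¬' a ⟧ v = f¬ (⟦ a ⟧ v)
⟦ a ∨' b ⟧ v = f∨ (⟦ a ⟧ v) (⟦ b ⟧ v)
⟦ a ∧' b ⟧ v = f∧ (⟦ a ⟧ v) (⟦ b ⟧ v)
⟦ a ⇒' b ⟧ v = f⇒ (⟦ a ⟧ v) (⟦ b ⟧ v)

FSet : Set₁
FSet = Pred For 0ℓ

_⊨G3_ : FSet → For → Set
Γ ⊨G3 α = (v : Valuation) → (∀ γ → γ ∈ Γ → ⟦ γ ⟧ v ≡ v1) → ⟦ α ⟧ v ≡ v1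

G3-consistent : FSet → Set
G3-consistent Γ = (∀ α → Γ ⊨G3 α) → ⊥

_⊨P_ : FSet → For → Set₁
Γ ⊨P α = Σ FSet (λ Γ' → (Γ' ⊆ Γ) × (G3-consistent Γ' × (Γ' ⊨G3 α)))

-- Take Γ = {p, ¬p}, Δ = {p, ¬p ∨ q} and α = q. Δ is satisfied by the constant-1 valuation and
-- yields q by disjunctive syllogism; p and ¬p ∨ q follow from the satisfiable parts {p} and {¬p}
-- of Γ. But every consistent part of Γ is satisfiable, and whatever satisfies it still does so
-- after q is reset to 0, because no member of Γ mentions q; so no consistent part of Γ yields q.
module Submission where

open import Defs
open import Data.Product using (Σ; _×_; _,_)
open import Data.Sum using (inj₁; inj₂)
open import Data.Empty using (⊥-elim)
open import Data.Nat using (zero; suc)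
open import Function using (id; const)
open import Relation.Unary using (_∈_; _⊆_; ｛_｝; _∪_)
open import Relation.Nullary using (¬_)
open import Relation.Binary.PropositionalEquality using (_≡_; _≢_; refl; trans)

_⊩_ : Valuation → FSet → Set
v ⊩ Γ = ∀ γ → γ ∈ Γ → ⟦ γ ⟧ v ≡ v1

⊩-singleton : ∀ {v a} → ⟦ a ⟧ v ≡ v1 → v ⊩ ｛ a ｝
⊩-singleton a≡1 _ refl = a≡1

∧¬-undesignated : ∀ a v → ⟦ a ∧' (¬' a) ⟧ v ≢ v1
∧¬-undesignated a v with ⟦ a ⟧ v
... | v0 = λ ()
... | v½ = λ ()
... | v1 = λ ()

satisfiable⇒consistent : ∀ {Γ v} → v ⊩ Γ → G3-consistent Γ
satisfiable⇒consistent {v = v} v⊩Γ ⊨all =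
  ∧¬-undesignated (var 0) v (⊨all (var 0 ∧' (¬' var 0)) v v⊩Γ)

consistent⇒¬¬satisfiable : ∀ {Γ} → G3-consistent Γ → ¬ (∀ v → ¬ v ⊩ Γ)
consistent⇒¬¬satisfiable cons unsat = cons (λ α v v⊩Γ → ⊥-elim (unsat v v⊩Γ))

satisfiable-entailment⇒⊨P : ∀ {Γ' Γ α v} →
  Γ' ⊆ Γ → v ⊩ Γ' → Γ' ⊨G3 α → Γ ⊨P α
satisfiable-entailment⇒⊨P Γ'⊆Γ v⊩Γ' Γ'⊨α =
  _ , Γ'⊆Γ , satisfiable⇒consistent v⊩Γ' , Γ'⊨α

¬⊨P-by-reinterpretation : ∀ {Γ α} →
  (∀ v → Σ Valuation λ u → ⟦ α ⟧ u ≢ v1 × (∀ γ → γ ∈ Γ → ⟦ γ ⟧ u ≡ ⟦ γ ⟧ v)) →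
  ¬ (Γ ⊨P α)
¬⊨P-by-reinterpretation reinterpret (Γ' , Γ'⊆Γ , cons , Γ'⊨α) =
  consistent⇒¬¬satisfiable cons λ v v⊩Γ' →
    let (u , u⊭α , agree) = reinterpret v
    in u⊭α (Γ'⊨α u (λ γ γ∈Γ' → trans (agree γ (Γ'⊆Γ γ∈Γ')) (v⊩Γ' γ γ∈Γ')))

∨-introˡ : ∀ a b v → ⟦ a ⟧ v ≡ v1 → ⟦ a ∨' b ⟧ v ≡ v1
∨-introˡ a b v a≡1 rewrite a≡1 = refl

disjunctive-syllogism : ∀ a b v → ⟦ a ⟧ v ≡ v1 → ⟦ (¬' a) ∨' b ⟧ v ≡ v1 → ⟦ b ⟧ v ≡ v1
disjunctive-syllogism a b v a≡1 ¬a∨b≡1 rewrite a≡1 with ⟦ b ⟧ v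
... | v1 = refl

p q : For
p = var 0
q = var 1

Γ₀ Δ₀ : FSet
Γ₀ = ｛ p ｝ ∪ ｛ ¬' p ｝
Δ₀ = ｛ p ｝ ∪ ｛ (¬' p) ∨' q ｝

Δ₀⊨q : Δ₀ ⊨G3 q
Δ₀⊨q v v⊩Δ₀ = disjunctive-syllogism p q v (v⊩Δ₀ p (inj₁ refl)) (v⊩Δ₀ _ (inj₂ refl))

Δ₀⊨Pq : Δ₀ ⊨P q
Δ₀⊨Pq = satisfiable-entailment⇒⊨P {α = q} {const v1} id const-v1⊩Δ₀ Δ₀⊨q
  where
    const-v1⊩Δ₀ : const v1 ⊩ Δ₀
    const-v1⊩Δ₀ _ (inj₁ refl) = refl
    const-v1⊩Δ₀ _ (inj₂ refl) = refl

Γ₀⊨PΔ₀ : ∀ δ → δ ∈ Δ₀ → Γ₀ ⊨P δ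
Γ₀⊨PΔ₀ _ (inj₁ refl) =
  satisfiable-entailment⇒⊨P {α = p} inj₁ (⊩-singleton {const v1} refl) (λ v v⊩p → v⊩p p refl)
Γ₀⊨PΔ₀ _ (inj₂ refl) =
  satisfiable-entailment⇒⊨P {α = (¬' p) ∨' q} inj₂ (⊩-singleton {const v0} refl)
    (λ v v⊩¬p → ∨-introˡ (¬' p) q v (v⊩¬p (¬' p) refl))

only-p : Valuation → Valuation
only-p v zero    = v zero
only-p v (suc _) = v0

Γ₀⊭Pq : ¬ (Γ₀ ⊨P q)
Γ₀⊭Pq = ¬⊨P-by-reinterpretation {α = q} λ v → only-p v , (λ ()) , agree v
  where
    agree : ∀ v γ → γ ∈ Γ₀ → ⟦ γ ⟧ (only-p v) ≡ ⟦ γ ⟧ v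
    agree v _ (inj₁ refl) = refl
    agree v _ (inj₂ refl) = refl

proposition17 : Σ FSet (λ Γ → Σ FSet (λ Δ → Σ For (λ α →
                  (Δ ⊨P α) × ((∀ δ → δ ∈ Δ → Γ ⊨P δ) × (¬ (Γ ⊨P α))))))
proposition17 = Γ₀ , Δ₀ , q , Δ₀⊨Pq , Γ₀⊨PΔ₀ , Γ₀⊭Pq
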